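{- Let $D$ be a finite set and let $V \subseteq \mathbb{F}_q^D$ be a linear code with minimum relative distance $\lambda=\Delta(V)$. Let $\epsilon, \delta > 0$ with $\epsilon < 1/3$ and $\delta < 1 - (1-\lambda + \epsilon)^{1/3}$. Let $u,u^* \in \mathbb{F}_q^D$ satisfy $$\Pr_{x \in \mathbb{F}_q} [ \Delta( u^* + x u, V) < \delta ] \geq \frac{2}{\epsilon^2 q},$$ where $x$ is uniform in $\mathbb{F}_q$. Then there exist $v, v^*\in V$ and $C \subseteq D$ such that simultaneously: $|C| \geq (1-\delta-\epsilon) |D|$, $u|_{C}=v|_{C}$, and $u^*|_{C}=v^*|_{C}$.
   Context: $\mathbb{F}_q^D$ is the space of functions $D\to\mathbb{F}_q$. $\Delta(u,v)=\Pr_{z\in D}[u(z)\neq v(z)]$ is relative Hamming distance; $\Delta(u,S)=\min_{s\in S}\Delta(u,s)$ and $\Delta(S)=\min_{s\neq s'\in S}\Delta(s,s')$. For $C\subseteq D$, $f|_C$ is the restriction of $f$ to $C$.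
   Formalization: The parameters ε and δ range over the positive rationals. -}

module Defs where

open import Level using (Level; _⊔_) renaming (suc to lsuc)
open import Algebra.Bundles using (CommutativeRing)
open import Data.Nat as ℕ using (ℕ)
open import Data.Fin as Fin using (Fin)
open import Data.Fin.Subset using (Subset; _∈_; ∣_∣)
open import Data.Integer using (+_)
import Data.Rational as Q
open Q using (ℚ; _/_)
open import Data.List using (List; length)
open import Data.List.Relation.Unary.All using (All)
open import Data.List.Relation.Unary.AllPairs using (AllPairs)
open import Data.Product using (Σ; ∃; _×_; _,_)
open import Relation.Nullary using (¬_; Dec; does)
open import Relation.Unary using (Pred)
open import Relation.Binary using (Decidable)
open import Relation.Binary.PropositionalEquality using (_≡_)
open import Data.Bool using (true; false)

record FiniteField (c ℓ : Level) : Set (lsuc (c ⊔ ℓ)) where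
  field
    cring : CommutativeRing c ℓ
  open CommutativeRing cring public
  field
    _≟_      : Decidable _≈_
    0≉1      : ¬ (0# ≈ 1#)
    inverse  : ∀ x → ¬ (x ≈ 0#) → ∃ λ y → (x * y) ≈ 1#
    q        : ℕ
    q-nonZero : ℕ.NonZero q  -- (follows from the rest; |F_q| ≥ 2)
    enum     : Fin q → Carrier
    enum-surj : ∀ x → ∃ λ i → enum i ≈ x
    enum-inj  : ∀ i j → enum i ≈ enum j → i ≡ j

module _ {c ℓ : Level} (F : FiniteField c ℓ) where
  open FiniteField F

  Word : ℕ → Set c
  Word n = Fin n → Carrier

  _⊕_ : ∀ {n} → Word n → Word n → Word n
  (u ⊕ v) z = u z + v z

  _⊙_ : ∀ {n} → Carrier → Word n → Word n
  (x ⊙ u) z = x * u z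

  𝟎 : ∀ {n} → Word n
  𝟎 z = 0#

  record IsLinearCode {n : ℕ} {p : Level} (V : Pred (Word n) p) : Set (c ⊔ ℓ ⊔ p) where
    field
      resp   : ∀ {u v} → (∀ z → u z ≈ v z) → V u → V v
      zero∈  : V 𝟎
      +-closed : ∀ {u v} → V u → V v → V (u ⊕ v)
      ·-closed : ∀ x {u} → V u → V (x ⊙ u)

  hamming : ∀ {n} → Word n → Word n → ℕ
  hamming {ℕ.zero}  u v = 0
  hamming {ℕ.suc n} u v with does (u Fin.zero ≟ v Fin.zero)
  ... | true  = hamming (λ z → u (Fin.suc z)) (λ z → v (Fin.suc z))
  ... | false = ℕ.suc (hamming (λ z → u (Fin.suc z)) (λ z → v (Fin.suc z)))

  Δ : ∀ {n} .{{_ : ℕ.NonZero n}} → Word n → Word n → ℚ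
  Δ {n} u v = (+ hamming u v) / n

  IsMinDist : ∀ {n} .{{_ : ℕ.NonZero n}} {p} → Pred (Word n) p → ℚ → Set (c ⊔ ℓ ⊔ p)
  IsMinDist V λ' =
    (Σ _ λ s → Σ _ λ s' → V s × V s' × ¬ (∀ z → s z ≈ s' z) × Δ s s' ≡ λ')
    × (∀ s s' → V s → V s' → ¬ (∀ z → s z ≈ s' z) → λ' Q.≤ Δ s s')

  -- Δ(w, V) < δ, i.e. the minimum over V of Δ(w, ·) is < δ
  CloseTo : ∀ {n} .{{_ : ℕ.NonZero n}} {p} → Word n → Pred (Word n) p → ℚ → Set (c ⊔ p)
  CloseTo w V δ = Σ _ λ v → V v × (Δ w v Q.< δ)

  -- Pr_{x ∈ F_q}[P x] ≥ r : there is a set of at least (r·q) elements of F_q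
  -- (given as a list of pairwise ≉ elements) all satisfying P, i.e. |{x | P x}| ≥ r·q
  -- (equivalently |{x | P x}|/q ≥ r, q > 0)
  PrAtLeast : ∀ {p} → Pred Carrier p → ℚ → Set (c ⊔ ℓ ⊔ p)
  PrAtLeast P r = Σ (List Carrier) λ xs →
    AllPairs (λ x y → ¬ (x ≈ y)) xs × All P xs × ((r Q.* ((+ q) / 1)) Q.≤ ((+ length xs) / 1))

module Submission where

-- Let A(z) count the xᵢ at which the received word u* + xᵢ u agrees with its δ-close codeword wᵢ
-- at z.  Closeness gives Σ A ≥ m n (1 − δ), and convexity of t ↦ t³ gives Σ A³ ≥ n (m (1 − δ))³.
-- Now Σ A³ counts triples (i, j, k) of agreements at a common point; as codewords closer than λ n
-- coincide, the hypothesis on δ forces many "good" triples, sharing more than (1 − λ) n points,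
-- and hence a pair i ≠ j lying in more than 1 + δ/ε good triples.  Let v* + x v be the line through
-- wᵢ at xᵢ and wⱼ at xⱼ: every good wₖ equals v* + xₖ v, and outside the set C where (u*, u) = (v*, v)
-- at most one of them can agree with u* + xₖ u.  Counting the agreements of the good wₖ gives
-- |C| ≥ (1 − δ − ε) n.

open import Defs
open import Data.Nat as ℕ using (ℕ)
open import Data.Fin using (Fin)
open import Data.Fin.Subset using (Subset; _∈_; ∣_∣)
open import Data.Integer using (+_)
open import Data.Rational as Q using (ℚ; _/_; 0ℚ; 1ℚ; 1/_; >-nonZero)
open import Data.Product using (Σ; _×_)
open import Relation.Unary using (Pred)
open import Relation.Nullary using (¬_)
open import Relation.Binary.PropositionalEquality using (_≡_; _≢_)

module FiniteSums where

  open import Data.Nat using (zero; suc; _+_; _*_; _≤_; z≤n; s≤s; _≤?_)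
  open import Data.Nat.Properties hiding (suc-injective)
  open import Data.Fin as Fin using ()
  open import Data.Fin.Properties using (suc-injective)
  open import Data.Vec using (tabulate)
  open import Data.Vec.Properties using ([]=⇒lookup; lookup∘tabulate)
  open import Data.Bool using (Bool; true; false)
  open import Data.Empty using (⊥; ⊥-elim)
  open import Function using (_∘_)
  open import Data.Product using (_,_)
  open import Relation.Nullary using (yes; no)
  open import Relation.Binary.PropositionalEquality
  open import Algebra.Properties.Semiring.Sum +-*-semiring
    using (sum; sum-cong-≗; ∑-distrib-+; ∑-comm; *-distribˡ-sum; *-distribʳ-sum)
  open import Algebra.Properties.CommutativeSemigroup +-commutativeSemigroup using (x∙yz≈y∙xz)

  χ : Bool → ℕ
  χ true  = 1
  χ false = 0

  χ≤1 : ∀ b → χ b ≤ 1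
  χ≤1 true  = ≤-refl
  χ≤1 false = z≤n

  sum-replicate : ∀ {k} c → sum {k} (λ _ → c) ≡ k * c
  sum-replicate {zero}  c = refl
  sum-replicate {suc k} c = cong (λ s → c + s) (sum-replicate {k} c)

  sum-mono-≤ : ∀ {k} {f g : Fin k → ℕ} → (∀ i → f i ≤ g i) → sum f ≤ sum g
  sum-mono-≤ {zero}  f≤g = z≤n
  sum-mono-≤ {suc k} f≤g = +-mono-≤ (f≤g Fin.zero) (sum-mono-≤ (f≤g ∘ Fin.suc))

  sum-≤-length : ∀ {k} {f : Fin k → ℕ} → (∀ i → f i ≤ 1) → sum f ≤ k
  sum-≤-length {k} {f} f≤1 = subst (sum f ≤_) (trans (sum-replicate {k} 1) (*-identityʳ k)) (sum-mono-≤ f≤1)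

  sum-mono-≤-except : ∀ {k} {f g : Fin k → ℕ} (i : Fin k) {c} →
    (∀ j → j ≢ i → f j ≤ g j) → f i ≤ c → sum f ≤ c + sum g
  sum-mono-≤-except {suc k} {f} {g} Fin.zero {c} f≤g fi≤c = begin
    f Fin.zero + sum (f ∘ Fin.suc) ≤⟨ +-mono-≤ fi≤c (sum-mono-≤ (λ j → f≤g (Fin.suc j) (λ ()))) ⟩
    c + sum (g ∘ Fin.suc)          ≤⟨ +-monoʳ-≤ c (m≤n+m _ (g Fin.zero)) ⟩
    c + sum g                      ∎
    where open ≤-Reasoning
  sum-mono-≤-except {suc k} {f} {g} (Fin.suc i) {c} f≤g fi≤c = begin
    f Fin.zero + sum (f ∘ Fin.suc) ≤⟨ +-mono-≤ (f≤g Fin.zero (λ ()))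
                                       (sum-mono-≤-except i (λ j j≢i → f≤g (Fin.suc j) (j≢i ∘ suc-injective)) fi≤c) ⟩
    g Fin.zero + (c + sum (g ∘ Fin.suc)) ≡⟨ x∙yz≈y∙xz (g Fin.zero) c _ ⟩
    c + sum g                      ∎
    where open ≤-Reasoning

  sum-χ-≤1 : ∀ {k} (b : Fin k → Bool) → (∀ i j → i ≢ j → b i ≡ true → b j ≡ true → ⊥) →
    sum (λ i → χ (b i)) ≤ 1
  sum-χ-≤1 {zero}  b atMostOne = z≤n
  sum-χ-≤1 {suc k} b atMostOne with b Fin.zero in b₀
  ... | false = sum-χ-≤1 (b ∘ Fin.suc) (λ i j i≢j → atMostOne (Fin.suc i) (Fin.suc j) (i≢j ∘ suc-injective))
  ... | true  = s≤s (≤-reflexive (trans (sum-cong-≗ rest-false) (trans (sum-replicate {k} 0) (*-zeroʳ k))))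
    where
    rest-false : ∀ i → χ (b (Fin.suc i)) ≡ 0
    rest-false i with b (Fin.suc i) in bᵢ
    ... | true  = ⊥-elim (atMostOne Fin.zero (Fin.suc i) (λ ()) b₀ bᵢ)
    ... | false = refl

  argmax : ∀ {k} (f : Fin (suc k) → ℕ) → Σ (Fin (suc k)) λ i → ∀ j → f j ≤ f i
  argmax {zero}  f = Fin.zero , λ { Fin.zero → ≤-refl }
  argmax {suc k} f with argmax (f ∘ Fin.suc)
  ... | i , maxᵢ with f Fin.zero ≤? f (Fin.suc i)
  ...   | yes f₀≤ = Fin.suc i , λ { Fin.zero → f₀≤ ; (Fin.suc j) → maxᵢ j }
  ...   | no  f₀≰ = Fin.zero  , λ { Fin.zero → ≤-refl ; (Fin.suc j) → ≤-trans (maxᵢ j) (<⇒≤ (≰⇒> f₀≰)) }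

  ∣tabulate∣ : ∀ {n} (b : Fin n → Bool) → ∣ tabulate b ∣ ≡ sum (λ z → χ (b z))
  ∣tabulate∣ {zero}  b = refl
  ∣tabulate∣ {suc n} b with b Fin.zero
  ... | true  = cong suc (∣tabulate∣ (b ∘ Fin.suc))
  ... | false = ∣tabulate∣ (b ∘ Fin.suc)

  ∈tabulate⇒ : ∀ {n} (b : Fin n → Bool) z → z ∈ tabulate b → b z ≡ true
  ∈tabulate⇒ b z z∈ = trans (sym (lookup∘tabulate b z)) ([]=⇒lookup z∈)

  ∑³ : ∀ {m} → (Fin m → Fin m → Fin m → ℕ) → ℕ
  ∑³ f = sum λ i → sum λ j → sum λ k → f i j k

  ∑³-mono-≤ : ∀ {m} {f g : Fin m → Fin m → Fin m → ℕ} → (∀ i j k → f i j k ≤ g i j k) → ∑³ f ≤ ∑³ g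
  ∑³-mono-≤ f≤g = sum-mono-≤ λ i → sum-mono-≤ λ j → sum-mono-≤ λ k → f≤g i j k

  ∑³-distrib-+ : ∀ {m} (f g : Fin m → Fin m → Fin m → ℕ) → ∑³ (λ i j k → f i j k + g i j k) ≡ ∑³ f + ∑³ g
  ∑³-distrib-+ f g = trans
    (sum-cong-≗ λ i → trans (sum-cong-≗ λ j → ∑-distrib-+ (f i j) (g i j))
                              (∑-distrib-+ (λ j → sum (f i j)) (λ j → sum (g i j))))
    (∑-distrib-+ (λ i → sum λ j → sum (f i j)) (λ i → sum λ j → sum (g i j)))

  ∑³-replicate : ∀ {m} c → ∑³ {m} (λ _ _ _ → c) ≡ m * (m * (m * c))
  ∑³-replicate {m} c = begin
    ∑³ {m} (λ _ _ _ → c)                ≡⟨ sum-cong-≗ {m} (λ _ → sum-cong-≗ {m} λ _ → sum-replicate {m} c) ⟩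
    sum {m} (λ _ → sum {m} λ _ → m * c) ≡⟨ sum-cong-≗ {m} (λ _ → sum-replicate {m} (m * c)) ⟩
    sum {m} (λ _ → m * (m * c))         ≡⟨ sum-replicate {m} (m * (m * c)) ⟩
    m * (m * (m * c))                   ∎
    where open ≡-Reasoning

  ∑³-*ʳ : ∀ {m} (f : Fin m → Fin m → Fin m → ℕ) c → ∑³ (λ i j k → f i j k * c) ≡ ∑³ f * c
  ∑³-*ʳ f c = sym (trans
    (*-distribʳ-sum c λ i → sum λ j → sum (f i j))
    (sum-cong-≗ λ i → trans (*-distribʳ-sum c λ j → sum (f i j)) (sum-cong-≗ λ j → *-distribʳ-sum c (f i j))))

  sum-cubed : ∀ {m} (a : Fin m → ℕ) → sum a * sum a * sum a ≡ ∑³ (λ i j k → a i * a j * a k)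
  sum-cubed a = begin
    sum a * sum a * sum a                          ≡⟨ cong (_* sum a) (*-distribʳ-sum (sum a) a) ⟩
    sum (λ i → a i * sum a) * sum a                ≡⟨ cong (_* sum a) (sum-cong-≗ λ i → *-distribˡ-sum (a i) a) ⟩
    sum (λ i → sum λ j → a i * a j) * sum a        ≡⟨ *-distribʳ-sum (sum a) (λ i → sum λ j → a i * a j) ⟩
    sum (λ i → (sum λ j → a i * a j) * sum a)      ≡⟨ sum-cong-≗ (λ i → *-distribʳ-sum (sum a) λ j → a i * a j) ⟩
    sum (λ i → sum λ j → a i * a j * sum a)        ≡⟨ sum-cong-≗ (λ i → sum-cong-≗ λ j → *-distribˡ-sum (a i * a j) a) ⟩
    ∑³ (λ i j k → a i * a j * a k)                 ∎
    where open ≡-Reasoning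

  ∑-∑³-comm : ∀ {n m} (f : Fin n → Fin m → Fin m → Fin m → ℕ) →
    sum (λ z → ∑³ (f z)) ≡ ∑³ (λ i j k → sum λ z → f z i j k)
  ∑-∑³-comm f = trans (∑-comm λ z i → sum λ j → sum λ k → f z i j k)
    (sum-cong-≗ λ i → trans (∑-comm λ z j → sum λ k → f z i j k) (sum-cong-≗ λ j → ∑-comm λ z k → f z i j k))

module RationalArithmetic where

  open import Data.Nat using (suc)
  import Data.Nat.Properties as ℕ
  import Data.Integer as ℤ
  import Data.Integer.Properties as ℤ
  open import Data.Rational using (mkℚ; _+_; _*_; _-_; -_; _≤_; _<_)
  open import Data.Rational.Properties
  import Data.Rational.Unnormalised as U
  import Data.Rational.Unnormalised.Properties as U
  open import Data.Rational.Solver using (module +-*-Solver)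
  open +-*-Solver
  import Data.Nat.Coprimality as Coprime
  open import Data.Sum using (inj₁; inj₂)
  open import Data.Empty using (⊥-elim)
  open import Relation.Nullary using (yes; no)
  open import Relation.Binary.PropositionalEquality

  ι : ℕ → ℚ
  ι k = + k / 1

  private
    ι-normal : ∀ k → ι k ≡ mkℚ (+ k) 0 (Coprime.sym (Coprime.1-coprimeTo k))
    ι-normal k = ↥p/↧p≡p (mkℚ (+ k) 0 (Coprime.sym (Coprime.1-coprimeTo k)))

  ι-+ : ∀ a b → ι (a ℕ.+ b) ≡ ι a + ι b
  ι-+ a b = trans (/-cong {p₂ = + a ℤ.* + 1 ℤ.+ + b ℤ.* + 1} {q₂ = 1} eq refl) (sym (cong₂ _+_ (ι-normal a) (ι-normal b)))
    where
    eq : + (a ℕ.+ b) ≡ + a ℤ.* + 1 ℤ.+ + b ℤ.* + 1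
    eq = trans (ℤ.pos-+ a b) (sym (cong₂ ℤ._+_ (ℤ.*-identityʳ (+ a)) (ℤ.*-identityʳ (+ b))))

  ι-* : ∀ a b → ι (a ℕ.* b) ≡ ι a * ι b
  ι-* a b = trans (/-cong {p₂ = + a ℤ.* + b} {q₂ = 1} (ℤ.pos-* a b) refl) (sym (cong₂ _*_ (ι-normal a) (ι-normal b)))

  ι-mono-≤ : ∀ {a b} → a ℕ.≤ b → ι a ≤ ι b
  ι-mono-≤ {a} {b} a≤b = subst₂ _≤_ (sym (ι-normal a)) (sym (ι-normal b))
    (Q.*≤* (subst₂ ℤ._≤_ (sym (ℤ.*-identityʳ (+ a))) (sym (ℤ.*-identityʳ (+ b))) (ℤ.+≤+ a≤b)))

  0≤ι : ∀ a → 0ℚ ≤ ι a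
  0≤ι a = ι-mono-≤ {0} {a} ℕ.z≤n

  ι-mono-< : ∀ {a b} → a ℕ.< b → ι a < ι b
  ι-mono-< {a} {b} a<b = <-≤-trans a<a+1 (ι-mono-≤ a<b)
    where
    a<a+1 : ι a < ι (suc a)
    a<a+1 = subst (ι a <_) (trans (+-comm (ι a) 1ℚ) (sym (ι-+ 1 a)))
      (subst (_< ι a + 1ℚ) (+-identityʳ (ι a)) (+-monoʳ-< (ι a) (positive⁻¹ 1ℚ)))

  ι-cancel-≤ : ∀ {a b} → ι a ≤ ι b → a ℕ.≤ b
  ι-cancel-≤ {a} {b} ιa≤ιb with a ℕ.≤? b
  ... | yes a≤b = a≤b
  ... | no  a≰b = ⊥-elim (<-irrefl refl (<-≤-trans (ι-mono-< (ℕ.≰⇒> a≰b)) ιa≤ιb))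

  [a/n]*n≡a : ∀ a n .{{_ : ℕ.NonZero n}} → ((+ a) / n) * ι n ≡ ι a
  [a/n]*n≡a a (suc n) = toℚᵘ-injective (U.≃-trans (toℚᵘ-homo-* ((+ a) / suc n) (ι (suc n)))
      (U.≃-trans (U.*-cong (toℚᵘ-fromℚᵘ (U.mkℚᵘ (+ a) n)) (toℚᵘ-cong (ι-normal (suc n))))
        (U.≃-trans (U.*≡* eq) (toℚᵘ-cong (sym (ι-normal a))))))
    where
    eq : (+ a ℤ.* + suc n) ℤ.* + 1 ≡ + a ℤ.* + suc (n ℕ.* 1)
    eq = trans (ℤ.*-identityʳ _) (cong (λ t → + a ℤ.* + suc t) (sym (ℕ.*-identityʳ n)))

  p≤q⇒0≤q-p : ∀ {p q} → p ≤ q → 0ℚ ≤ q - p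
  p≤q⇒0≤q-p {p} {q} p≤q = subst (_≤ q - p) (+-inverseʳ p) (+-monoˡ-≤ (- p) p≤q)

  p<q⇒0<q-p : ∀ {p q} → p < q → 0ℚ < q - p
  p<q⇒0<q-p {p} {q} p<q = subst (_< q - p) (+-inverseʳ p) (+-monoˡ-< (- p) p<q)

  p+[q-p]≡q : ∀ p q → p + (q - p) ≡ q
  p+[q-p]≡q = solve 2 (λ p q → p :+ (q :- p) := q) refl

  ≤-by-difference : ∀ {p q} d → 0ℚ ≤ d → d ≡ q - p → p ≤ q
  ≤-by-difference {p} {q} d 0≤d refl = subst₂ _≤_ (+-identityʳ p) (p+[q-p]≡q p q) (+-monoʳ-≤ p 0≤d)

  <-by-difference : ∀ {p q} d → 0ℚ < d → d ≡ q - p → p < q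
  <-by-difference {p} {q} d 0<d refl = subst₂ _<_ (+-identityʳ p) (p+[q-p]≡q p q) (+-monoʳ-< p 0<d)

  0≤* : ∀ {p q} → 0ℚ ≤ p → 0ℚ ≤ q → 0ℚ ≤ p * q
  0≤* {p} {q} 0≤p 0≤q = subst (_≤ p * q) (*-zeroʳ p) (*-monoˡ-≤-nonNeg p {{Q.nonNegative 0≤p}} 0≤q)

  0<* : ∀ {p q} → 0ℚ < p → 0ℚ < q → 0ℚ < p * q
  0<* {p} {q} 0<p 0<q = subst (_< p * q) (*-zeroʳ p) (*-monoʳ-<-pos p {{Q.positive 0<p}} 0<q)

  0≤p*p : ∀ p → 0ℚ ≤ p * p
  0≤p*p p with ≤-total 0ℚ p
  ... | inj₁ 0≤p = 0≤* 0≤p 0≤p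
  ... | inj₂ p≤0 = subst (0ℚ ≤_) (solve 1 (λ p → (:- p) :* (:- p) := p :* p) refl p) (0≤* 0≤-p 0≤-p)
    where
    0≤-p : 0ℚ ≤ - p
    0≤-p = subst (0ℚ ≤_) (+-identityˡ (- p)) (p≤q⇒0≤q-p p≤0)

  0<p*q⇒0<q : ∀ {p q} → 0ℚ < p → 0ℚ < p * q → 0ℚ < q
  0<p*q⇒0<q {p} {q} 0<p 0<pq = *-cancelˡ-<-nonNeg p {{Q.nonNegative (<⇒≤ 0<p)}} (subst (_< p * q) (sym (*-zeroʳ p)) 0<pq)

  0≤p*q⇒0≤q : ∀ {p q} → 0ℚ < p → 0ℚ ≤ p * q → 0ℚ ≤ q
  0≤p*q⇒0≤q {p} {q} 0<p 0≤pq = *-cancelˡ-≤-pos p {{Q.positive 0<p}} (subst (_≤ p * q) (sym (*-zeroʳ p)) 0≤pq)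

  0<p*p*p⇒0<p : ∀ {p} → 0ℚ < p * p * p → 0ℚ < p
  0<p*p*p⇒0<p {p} 0<p³ with 0ℚ Q.<? p
  ... | yes 0<p = 0<p
  ... | no  0≮p = ⊥-elim (<-irrefl refl (<-≤-trans 0<p³ p³≤0))
    where
    p³≤0 : p * p * p ≤ 0ℚ
    p³≤0 = subst (p * p * p ≤_) (*-zeroʳ (p * p)) (*-monoˡ-≤-nonNeg (p * p) {{Q.nonNegative (0≤p*p p)}} (≮⇒≥ 0≮p))

  cube-tangent : ∀ {t μ} → 0ℚ ≤ t → 0ℚ ≤ μ → ι 3 * (μ * μ) * t ≤ t * t * t + ι 2 * (μ * μ * μ)
  cube-tangent {t} {μ} 0≤t 0≤μ = ≤-by-difference _ (0≤* (0≤p*p (t - μ)) (+-mono-≤ (+-mono-≤ 0≤t 0≤μ) 0≤μ))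
    (solve 2 (λ t μ → (t :- μ) :* (t :- μ) :* (t :+ μ :+ μ)
                     := t :* t :* t :+ con (ι 2) :* (μ :* μ :* μ) :- con (ι 3) :* (μ :* μ) :* t) refl t μ)

module CountingInequalities where

  open import Data.Nat using (zero; suc)
  open import Data.Nat.Properties using (+-*-semiring)
  open import Data.Fin as Fin using ()
  open import Data.Rational using (_+_; _*_; _-_; _≤_; _<_)
  open import Data.Rational.Properties
  open import Data.Rational.Solver using (module +-*-Solver)
  open +-*-Solver
  open import Relation.Binary.PropositionalEquality
  open import Function using (_∘_)
  open import Algebra.Properties.Semiring.Sum +-*-semiring using (sum)
  open RationalArithmetic

  ι-sum-≤-affine : ∀ {k} (f g : Fin k → ℕ) (a b : ℚ) → (∀ i → a * ι (g i) ≤ ι (f i) + b) →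
    a * ι (sum g) ≤ ι (sum f) + ι k * b
  ι-sum-≤-affine {zero}  f g a b _ = ≤-reflexive (solve 2 (λ a b → a :* con 0ℚ := con 0ℚ :+ con 0ℚ :* b) refl a b)
  ι-sum-≤-affine {suc k} f g a b f≥ = subst₂ _≤_
    (sym (cong (a *_) (ι-+ (g Fin.zero) _)))
    (sym (trans (cong₂ (λ s k+1 → s + k+1 * b) (ι-+ (f Fin.zero) _) (ι-+ 1 k))
      (solve 5 (λ f₀ s k b a → (f₀ :+ s) :+ (con 1ℚ :+ k) :* b := (f₀ :+ b) :+ (s :+ k :* b)) refl (ι (f Fin.zero)) (ι (sum (f ∘ Fin.suc))) (ι k) b a)))
    (subst (_≤ _) (sym (*-distribˡ-+ a _ _))
      (+-mono-≤ (f≥ Fin.zero) (ι-sum-≤-affine (f ∘ Fin.suc) (g ∘ Fin.suc) a b (f≥ ∘ Fin.suc))))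

  ι-sum-≤-scaled : ∀ {k} (f g : Fin k → ℕ) r → (∀ i → ι (f i) ≤ ι (g i) * r) → ι (sum f) ≤ ι (sum g) * r
  ι-sum-≤-scaled {zero}  f g r _ = ≤-reflexive (sym (*-zeroˡ r))
  ι-sum-≤-scaled {suc k} f g r f≤ = subst₂ _≤_
    (sym (ι-+ (f Fin.zero) _))
    (sym (trans (cong (_* r) (ι-+ (g Fin.zero) _)) (*-distribʳ-+ r (ι (g Fin.zero)) (ι (sum (g ∘ Fin.suc))))))
    (+-mono-≤ (f≤ Fin.zero) (ι-sum-≤-scaled (f ∘ Fin.suc) (g ∘ Fin.suc) r (f≤ ∘ Fin.suc)))

  mean-cube-bound : ∀ {N} (A : Fin N → ℕ) {μ} → 0ℚ ≤ μ → ι N * μ ≤ ι (sum A) →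
    ι N * (μ * μ * μ) ≤ ι (sum λ z → A z ℕ.* A z ℕ.* A z)
  mean-cube-bound {N} A {μ} 0≤μ mean≥μ = ≤-by-difference (S₃ + ι N * (ι 2 * (μ * μ * μ)) - ι 3 * (μ * μ) * S₁ + ι 3 * (μ * μ) * (S₁ - ι N * μ))
    (+-mono-≤ (p≤q⇒0≤q-p tangents) (0≤* (0≤* (0≤ι 3) (0≤p*p μ)) (p≤q⇒0≤q-p mean≥μ)))
    (solve 4 (λ N μ S₁ S₃ → (S₃ :+ N :* (con (ι 2) :* (μ :* μ :* μ)) :- con (ι 3) :* (μ :* μ) :* S₁) :+ con (ι 3) :* (μ :* μ) :* (S₁ :- N :* μ)
                          := S₃ :- N :* (μ :* μ :* μ)) refl (ι N) μ S₁ S₃)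
    where
    S₁ S₃ : ℚ
    S₁ = ι (sum A)
    S₃ = ι (sum λ z → A z ℕ.* A z ℕ.* A z)
    tangents : ι 3 * (μ * μ) * S₁ ≤ S₃ + ι N * (ι 2 * (μ * μ * μ))
    tangents = ι-sum-≤-affine (λ z → A z ℕ.* A z ℕ.* A z) A (ι 3 * (μ * μ)) (ι 2 * (μ * μ * μ)) λ z →
      subst (λ c → ι 3 * (μ * μ) * ι (A z) ≤ c + ι 2 * (μ * μ * μ)) (sym (trans (ι-* (A z ℕ.* A z) (A z)) (cong (_* ι (A z)) (ι-* (A z) (A z)))))
        (cube-tangent (0≤ι (A z)) 0≤μ)

  first-moment-bound : ∀ {N m δ S D} → S + D ≡ m * N → D ≤ m * (δ * N) → N * (m * (1ℚ - δ)) ≤ S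
  first-moment-bound {N} {m} {δ} {S} {D} S+D≡mN D≤mδN = ≤-by-difference _ (p≤q⇒0≤q-p D≤mδN)
    (begin
      m * (δ * N) - D                          ≡⟨ solve 5 (λ N m δ S D → m :* (δ :* N) :- D := (S :- N :* (m :* (con 1ℚ :- δ))) :+ (m :* N :- (S :+ D))) refl N m δ S D ⟩
      (S - N * (m * (1ℚ - δ))) + (m * N - (S + D)) ≡⟨ cong (λ t → (S - N * (m * (1ℚ - δ))) + (m * N - t)) S+D≡mN ⟩
      (S - N * (m * (1ℚ - δ))) + (m * N - m * N) ≡⟨ solve 4 (λ N m δ S → (S :- N :* (m :* (con 1ℚ :- δ))) :+ (m :* N :- m :* N) := S :- N :* (m :* (con 1ℚ :- δ))) refl N m δ S ⟩
      S - N * (m * (1ℚ - δ))                   ∎)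
    where open ≡-Reasoning

  good-triples-lower-bound : ∀ {N m δ ε lam S G} → 0ℚ < m → 0ℚ < N → lam * N ≤ N → 0ℚ ≤ G →
    S + m * m * m * (lam * N) ≤ m * m * m * N + G * (lam * N) →
    N * ((m * (1ℚ - δ)) * (m * (1ℚ - δ)) * (m * (1ℚ - δ))) ≤ S →
    1ℚ - lam + ε < (1ℚ - δ) * (1ℚ - δ) * (1ℚ - δ) →
    m * m * m * ε < G
  good-triples-lower-bound {N} {m} {δ} {ε} {lam} {S} {G} 0<m 0<N lamN≤N 0≤G counted S≥ cube-gap =
    <-by-difference (G - m * m * m * ε) (0<p*q⇒0<q 0<N (subst (0ℚ <_) certificate
      (+-mono-<-≤ (0<* (0<* 0<N (0<* (0<* 0<m 0<m) 0<m)) (p<q⇒0<q-p cube-gap))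
           (+-mono-≤ (0≤* 0≤G (p≤q⇒0≤q-p lamN≤N)) (+-mono-≤ (p≤q⇒0≤q-p counted) (p≤q⇒0≤q-p S≥))))))
      refl
    where
    certificate : (N * (m * m * m)) * (((1ℚ - δ) * (1ℚ - δ) * (1ℚ - δ)) - (1ℚ - lam + ε))
        + (G * (N - lam * N) + ((m * m * m * N + G * (lam * N) - (S + m * m * m * (lam * N)))
        + (S - N * ((m * (1ℚ - δ)) * (m * (1ℚ - δ)) * (m * (1ℚ - δ)))))) ≡ N * (G - m * m * m * ε)
    certificate = solve 7 (λ N m δ ε lam S G → (N :* (m :* m :* m)) :* (((con 1ℚ :- δ) :* (con 1ℚ :- δ) :* (con 1ℚ :- δ)) :- (con 1ℚ :- lam :+ ε))
        :+ (G :* (N :- lam :* N) :+ ((m :* m :* m :* N :+ G :* (lam :* N) :- (S :+ m :* m :* m :* (lam :* N)))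
        :+ (S :- N :* ((m :* (con 1ℚ :- δ)) :* (m :* (con 1ℚ :- δ)) :* (m :* (con 1ℚ :- δ)))))) := N :* (G :- m :* m :* m :* ε)) refl N m δ ε lam S G

  pair-count-lower-bound : ∀ {m ε δ G M} → 0ℚ < m → 0ℚ < ε → ε < + 1 / 3 → δ < 1ℚ →
    ι 2 ≤ m * (ε * ε) → G ≤ m * m * (1ℚ + M) → m * m * m * ε < G →
    δ < (M - 1ℚ) * ε
  pair-count-lower-bound {m} {ε} {δ} {G} {M} 0<m 0<ε ε<1/3 δ<1 2≤mε² G≤ G> =
    <-by-difference _ (+-mono-<-≤ (0<* 0<1+M-mε 0<ε) (+-mono-≤ (p≤q⇒0≤q-p 2≤mε²) (<⇒≤ 0<2-2ε-δ)))
      (solve 4 (λ m ε δ M → ((con 1ℚ :+ M) :- m :* ε) :* ε :+ ((m :* (ε :* ε) :- con (ι 2)) :+ (con (ι 2) :- ε :- ε :- δ))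
                          := (M :- con 1ℚ) :* ε :- δ) refl m ε δ M)
    where
    0<1+M-mε : 0ℚ < (1ℚ + M) - m * ε
    0<1+M-mε = 0<p*q⇒0<q (0<* 0<m 0<m) (subst (0ℚ <_)
      (solve 3 (λ m ε M → m :* m :* (con 1ℚ :+ M) :- m :* m :* m :* ε := m :* m :* ((con 1ℚ :+ M) :- m :* ε)) refl m ε M)
      (p<q⇒0<q-p (<-≤-trans G> G≤)))
    0<2-2ε-δ : 0ℚ < ι 2 - ε - ε - δ
    0<2-2ε-δ = subst (0ℚ <_)
      (solve 2 (λ ε δ → (con 1ℚ :- δ) :+ (con (ι 3) :* (con (+ 1 / 3) :- ε) :+ ε) := con (ι 2) :- ε :- ε :- δ) refl ε δ)
      (+-mono-<-≤ (p<q⇒0<q-p δ<1) (<⇒≤ (+-mono-<-≤ (0<* (positive⁻¹ (ι 3)) (p<q⇒0<q-p ε<1/3)) (<⇒≤ 0<ε))))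

  1<M : ∀ {M δ ε} → 0ℚ < δ → 0ℚ < ε → δ < (M - 1ℚ) * ε → 1ℚ < M
  1<M {M} {δ} {ε} 0<δ 0<ε δ<[M-1]ε = <-by-difference _
    (0<p*q⇒0<q 0<ε (subst (0ℚ <_) (*-comm (M - 1ℚ) ε) (<-trans 0<δ δ<[M-1]ε))) refl

  agreement-set-lower-bound : ∀ {N M δ ε E C} → 0ℚ ≤ N → 0ℚ < δ → 0ℚ < ε →
    E ≤ M * (δ * N) → M * N + C ≤ E + C * M + N → δ < (M - 1ℚ) * ε →
    (1ℚ - δ - ε) * N ≤ C
  agreement-set-lower-bound {N} {M} {δ} {ε} {E} {C} 0≤N 0<δ 0<ε E≤ counted δ< =
    ≤-by-difference _ (0≤p*q⇒0≤q 0<M-1 (subst (0ℚ ≤_) certificate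
      (+-mono-≤ (p≤q⇒0≤q-p counted) (+-mono-≤ (p≤q⇒0≤q-p E≤) (0≤* 0≤N (<⇒≤ (p<q⇒0<q-p δ<)))))))
      refl
    where
    0<M-1 : 0ℚ < M - 1ℚ
    0<M-1 = p<q⇒0<q-p (1<M {M} 0<δ 0<ε δ<)
    certificate : (E + C * M + N - (M * N + C)) + ((M * (δ * N) - E) + N * ((M - 1ℚ) * ε - δ))
                ≡ (M - 1ℚ) * (C - (1ℚ - δ - ε) * N)
    certificate = solve 6 (λ N M δ ε E C → (E :+ C :* M :+ N :- (M :* N :+ C)) :+ ((M :* (δ :* N) :- E) :+ N :* ((M :- con 1ℚ) :* ε :- δ))
                                        := (M :- con 1ℚ) :* (C :- (con 1ℚ :- δ :- ε) :* N)) refl N M δ ε E C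

  δ<1 : ∀ {lam ε δ} → lam ≤ 1ℚ → 0ℚ < ε → 1ℚ - lam + ε < (1ℚ - δ) * (1ℚ - δ) * (1ℚ - δ) → δ < 1ℚ
  δ<1 {lam} {ε} {δ} lam≤1 0<ε cube-gap = <-by-difference _
    (0<p*p*p⇒0<p (<-trans (subst (0ℚ <_) (+-comm ε (1ℚ - lam)) (+-mono-<-≤ 0<ε (p≤q⇒0≤q-p lam≤1))) cube-gap)) refl

  count-from-probability : ∀ q .{{_ : ℕ.NonZero q}} ε (0<ε : 0ℚ < ε) k →
    ((+ 2 / q) * (1/_ ε {{Q.>-nonZero 0<ε}}) * (1/_ ε {{Q.>-nonZero 0<ε}})) * ι q ≤ ι k → ι 2 ≤ ι k * (ε * ε)
  count-from-probability q ε 0<ε k bound =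
    subst (_≤ ι k * (ε * ε)) 2/q*q*ε⁻²*ε²≡2 (*-monoʳ-≤-nonNeg (ε * ε) {{Q.nonNegative (0≤p*p ε)}} bound)
    where
    ε⁻¹ : ℚ
    ε⁻¹ = 1/_ ε {{Q.>-nonZero 0<ε}}
    2/q*q*ε⁻²*ε²≡2 : ((+ 2 / q) * ε⁻¹ * ε⁻¹) * ι q * (ε * ε) ≡ ι 2
    2/q*q*ε⁻²*ε²≡2 = begin
      ((+ 2 / q) * ε⁻¹ * ε⁻¹) * ι q * (ε * ε)  ≡⟨ solve 4 (λ a e n ε → ((a :* e :* e) :* n) :* (ε :* ε) := (a :* n) :* (e :* ε) :* (e :* ε)) refl (+ 2 / q) ε⁻¹ (ι q) ε ⟩
      ((+ 2 / q) * ι q) * (ε⁻¹ * ε) * (ε⁻¹ * ε) ≡⟨ cong₂ (λ s t → s * t * t) ([a/n]*n≡a 2 q) (*-inverseˡ ε {{Q.>-nonZero 0<ε}}) ⟩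
      ι 2 * 1ℚ * 1ℚ                             ≡⟨⟩
      ι 2                                       ∎
      where open ≡-Reasoning

open RationalArithmetic using (ι)

module Hamming {c ℓ} (F : FiniteField c ℓ) where

  open import Data.Nat using (zero; suc; _+_; _≤_)
  open import Data.Nat.Properties using (+-suc; m≤m+n; +-*-semiring)
  open import Data.Fin as Fin using ()
  open import Data.Bool using (true; false)
  open import Function using (_∘_)
  open import Relation.Nullary using (does)
  open import Relation.Binary.PropositionalEquality using (refl; trans; cong; subst)
  open import Algebra.Properties.Semiring.Sum +-*-semiring using (sum)
  open FiniteSums using (χ)
  open FiniteField F using (_≟_)

  hamming+agreements : ∀ {k} (a b : Word F k) → hamming F a b + sum (λ z → χ (does (a z ≟ b z))) ≡ k
  hamming+agreements {zero}  a b = refl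
  hamming+agreements {suc k} a b with does (a Fin.zero ≟ b Fin.zero)
  ... | true  = trans (+-suc _ _) (cong suc (hamming+agreements (a ∘ Fin.suc) (b ∘ Fin.suc)))
  ... | false = cong suc (hamming+agreements (a ∘ Fin.suc) (b ∘ Fin.suc))

  hamming≤length : ∀ {k} (a b : Word F k) → hamming F a b ≤ k
  hamming≤length a b = subst (hamming F a b ≤_) (hamming+agreements a b) (m≤m+n _ _)

module Lines {c ℓ} (F : FiniteField c ℓ) where

  open import Data.Product using (_,_)
  open import Function using (_∘_)

  open FiniteField F
  open import Algebra.Properties.Ring ring using (-1*x≈-x; -‿distribˡ-*; [y-z]x≈yx-zx)
  open import Algebra.Properties.Group +-group using (x∙y⁻¹≈ε⇒x≈y; ∙-cancelʳ)
  open import Algebra.Properties.AbelianGroup +-abelianGroup using (⁻¹-∙-comm; ⁻¹-anti-homo‿-)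
  open import Algebra.Properties.CommutativeSemigroup +-commutativeSemigroup using (interchange)
  open import Relation.Binary.Reasoning.Setoid setoid

  *-cancelˡ-nonZero : ∀ {d a b} → ¬ (d ≈ 0#) → d * a ≈ d * b → a ≈ b
  *-cancelˡ-nonZero {d} {a} {b} d≉0 da≈db with inverse d d≉0
  ... | e , de≈1 = begin
    a             ≈⟨ sym (*-identityˡ a) ⟩
    1# * a        ≈⟨ *-cong (trans (sym de≈1) (*-comm d e)) refl ⟩
    (e * d) * a   ≈⟨ *-assoc e d a ⟩
    e * (d * a)   ≈⟨ *-cong refl da≈db ⟩
    e * (d * b)   ≈⟨ sym (*-assoc e d b) ⟩
    (e * d) * b   ≈⟨ *-cong (trans (*-comm e d) de≈1) refl ⟩
    1# * b        ≈⟨ *-identityˡ b ⟩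
    b             ∎

  [a+p]-[a+q]≈p-q : ∀ a p q → (a + p) - (a + q) ≈ p - q
  [a+p]-[a+q]≈p-q a p q = begin
    (a + p) + - (a + q)      ≈⟨ +-cong refl (sym (⁻¹-∙-comm a q)) ⟩
    (a + p) + (- a + - q)    ≈⟨ interchange a p (- a) (- q) ⟩
    (a + - a) + (p + - q)    ≈⟨ +-cong (-‿inverseʳ a) refl ⟩
    0# + (p + - q)           ≈⟨ +-identityˡ _ ⟩
    p - q                    ∎

  x≉y⇒x-y≉0 : ∀ {x y} → ¬ (x ≈ y) → ¬ (x - y ≈ 0#)
  x≉y⇒x-y≉0 {x} {y} x≉y = x≉y ∘ x∙y⁻¹≈ε⇒x≈y x y

  line-unique : ∀ {x x' a b a' b'} → ¬ (x ≈ x') →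
    a + x * b ≈ a' + x * b' → a + x' * b ≈ a' + x' * b' → b ≈ b' × a ≈ a'
  line-unique {x} {x'} {a} {b} {a'} {b'} x≉x' at-x at-x' = b≈b' , a≈a'
    where
    b≈b' : b ≈ b'
    b≈b' = *-cancelˡ-nonZero (x≉y⇒x-y≉0 x≉x') (begin
      (x - x') * b                    ≈⟨ [y-z]x≈yx-zx b x x' ⟩
      x * b - x' * b                  ≈⟨ sym ([a+p]-[a+q]≈p-q a (x * b) (x' * b)) ⟩
      (a + x * b) - (a + x' * b)      ≈⟨ +-cong at-x (-‿cong at-x') ⟩
      (a' + x * b') - (a' + x' * b')  ≈⟨ [a+p]-[a+q]≈p-q a' (x * b') (x' * b') ⟩
      x * b' - x' * b'                ≈⟨ sym ([y-z]x≈yx-zx b' x x') ⟩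
      (x - x') * b'                   ∎)
    a≈a' : a ≈ a'
    a≈a' = ∙-cancelʳ (x * b') a a' (trans (+-cong refl (*-cong refl (sym b≈b'))) at-x)

  [-y]z+yz≈0 : ∀ y z → (- y) * z + y * z ≈ 0#
  [-y]z+yz≈0 y z = trans (sym (distribʳ z (- y) y)) (trans (*-cong (-‿inverseˡ y) refl) (zeroˡ z))

  -- The slope is written as c * (p + (- 1#) * p') to match c ⊙ (w ⊕ (- 1#) ⊙ w'), which lies in a
  -- linear code by closure alone.
  module Interpolation {x x' c : Carrier} (x-x'*c≈1 : (x - x') * c ≈ 1#) (p p' : Carrier) where

    slope : Carrier
    slope = c * (p + (- 1#) * p')

    intercept : Carrier
    intercept = p + (- x) * slope

    intercept+x*slope≈p : intercept + x * slope ≈ p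
    intercept+x*slope≈p = begin
      (p + (- x) * slope) + x * slope  ≈⟨ +-assoc p _ _ ⟩
      p + ((- x) * slope + x * slope)  ≈⟨ +-cong refl ([-y]z+yz≈0 x slope) ⟩
      p + 0#                           ≈⟨ +-identityʳ p ⟩
      p                                ∎

    intercept+x'*slope≈p' : intercept + x' * slope ≈ p'
    intercept+x'*slope≈p' = begin
      (p + (- x) * slope) + x' * slope ≈⟨ +-assoc p _ _ ⟩
      p + ((- x) * slope + x' * slope) ≈⟨ +-cong refl (sym (distribʳ slope (- x) x')) ⟩
      p + (- x + x') * slope           ≈⟨ +-cong refl (*-cong (trans (+-comm (- x) x') (sym (⁻¹-anti-homo‿- x x'))) refl) ⟩
      p + (- (x - x')) * slope         ≈⟨ +-cong refl (sym (-‿distribˡ-* (x - x') slope)) ⟩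
      p + - ((x - x') * slope)         ≈⟨ +-cong refl (-‿cong (sym (*-assoc (x - x') c _))) ⟩
      p + - (((x - x') * c) * (p + (- 1#) * p')) ≈⟨ +-cong refl (-‿cong (*-cong x-x'*c≈1 (+-cong refl (-1*x≈-x p')))) ⟩
      p + - (1# * (p - p'))            ≈⟨ +-cong refl (-‿cong (*-identityˡ _)) ⟩
      p + - (p - p')                   ≈⟨ +-cong refl (⁻¹-anti-homo‿- p p') ⟩
      p + (p' - p)                     ≈⟨ +-cong refl (+-comm p' (- p)) ⟩
      p + (- p + p')                   ≈⟨ sym (+-assoc p (- p) p') ⟩
      (p - p) + p'                     ≈⟨ +-cong (-‿inverseʳ p) refl ⟩
      0# + p'                          ≈⟨ +-identityˡ p' ⟩
      p'                               ∎

module Agreement {c ℓ p} (F : FiniteField c ℓ) {n : ℕ}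
  (V : Pred (Word F n) p) (linear : IsLinearCode F V)
  (h : ℕ) (distance≥h : ∀ a b → V a → V b → hamming F a b ℕ.< h → ∀ z → FiniteField._≈_ F (a z) (b z))
  (u u* : Word F n) {m₀ : ℕ} (x : Fin (ℕ.suc m₀) → FiniteField.Carrier F)
  (x-distinct : ∀ i j → i ≢ j → ¬ FiniteField._≈_ F (x i) (x j))
  (w : Fin (ℕ.suc m₀) → Word F n) (w∈V : ∀ i → V (w i))
  where

  open import Data.Nat using (suc; _+_; _*_; _≤_; _<_; _<?_; z≤n)
  open import Data.Nat.Properties hiding (_≟_)
  open import Data.Fin as Fin using ()
  open import Data.Vec using (tabulate)
  open import Data.Bool using (Bool; true; false; _∧_)
  open import Data.Product using (_,_; proj₁; proj₂)
  open import Data.Empty using (⊥-elim)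
  open import Function using (_∘_)
  open import Relation.Nullary using (Dec; yes; no; does; _×-dec_)
  open import Relation.Nullary.Decidable using (dec-true)
  open import Relation.Binary.PropositionalEquality using (refl; sym; trans; cong; cong₂; subst; module ≡-Reasoning)
  open import Algebra.Properties.Semiring.Sum +-*-semiring
    using (sum; sum-cong-≗; ∑-distrib-+; ∑-comm; *-distribˡ-sum; *-distribʳ-sum)
  open import Algebra.Properties.CommutativeSemigroup +-commutativeSemigroup using (xy∙z≈xz∙y; xy∙z≈zy∙x)
  open FiniteSums
  open Hamming F
  open Lines F

  open FiniteField F using (_≈_; _≟_)
  module 𝔽 = FiniteField F
  open IsLinearCode linear

  from-does : ∀ {a} {A : Set a} (a? : Dec A) → does a? ≡ true → A
  from-does (yes a) _ = a
  from-does (no _) ()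

  m : ℕ
  m = suc m₀

  line : Fin m → Word F n
  line i = _⊕_ F u* (_⊙_ F (x i) u)

  agrees : Fin m → Fin n → Bool
  agrees i z = does (line i z ≟ w i z)

  multiplicity : Fin n → ℕ
  multiplicity z = sum λ i → χ (agrees i z)

  distance : Fin m → ℕ
  distance i = hamming F (line i) (w i)

  common : Fin m → Fin m → Fin m → ℕ
  common i j k = sum λ z → χ (agrees i z) * χ (agrees j z) * χ (agrees k z)

  -- common i j k > n − h, written without truncated subtraction
  good? : ∀ i j k → Dec (n < h + common i j k)
  good? i j k = n <? h + common i j k

  good : Fin m → Fin m → Fin m → Bool
  good i j k = does (good? i j k)

  goodCount : ℕ
  goodCount = ∑³ λ i j k → χ (good i j k)

  multiplicity+distance : sum multiplicity + sum distance ≡ m * n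
  multiplicity+distance = begin
    sum multiplicity + sum distance
      ≡⟨ cong (_+ sum distance) (∑-comm λ z i → χ (agrees i z)) ⟩
    sum (λ i → sum λ z → χ (agrees i z)) + sum distance
      ≡⟨ +-comm _ (sum distance) ⟩
    sum distance + sum (λ i → sum λ z → χ (agrees i z))
      ≡⟨ sym (∑-distrib-+ distance λ i → sum λ z → χ (agrees i z)) ⟩
    sum (λ i → distance i + sum λ z → χ (agrees i z))
      ≡⟨ sum-cong-≗ (λ i → hamming+agreements (line i) (w i)) ⟩
    sum {m} (λ _ → n)
      ≡⟨ sum-replicate {m} n ⟩
    m * n ∎
    where open ≡-Reasoning

  χ*χ*χ≤χ∧∧ : ∀ a b c → χ a * χ b * χ c ≤ χ (a ∧ b ∧ c)
  χ*χ*χ≤χ∧∧ true  true  true  = ≤-refl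
  χ*χ*χ≤χ∧∧ true  true  false = z≤n
  χ*χ*χ≤χ∧∧ true  false _     = z≤n
  χ*χ*χ≤χ∧∧ false _     _     = z≤n

  common≤n : ∀ i j k → common i j k ≤ n
  common≤n i j k = sum-≤-length λ z → ≤-trans (χ*χ*χ≤χ∧∧ (agrees i z) (agrees j z) (agrees k z)) (χ≤1 _)

  common+h≤n+good*h : ∀ i j k → common i j k + h ≤ n + χ (good i j k) * h
  common+h≤n+good*h i j k = bound (common≤n i j k) (good? i j k)
    where
    bound : ∀ {t} → t ≤ n → (d : Dec (n < h + t)) → t + h ≤ n + χ (does d) * h
    bound t≤n (yes _)      = +-mono-≤ t≤n (≤-reflexive (sym (+-identityʳ h)))
    bound t≤n (no ¬n<h+t) = ≤-trans (≤-reflexive (+-comm _ h)) (≤-trans (≮⇒≥ ¬n<h+t) (m≤m+n n 0))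

  Σmultiplicity³ : ℕ
  Σmultiplicity³ = sum λ z → multiplicity z * multiplicity z * multiplicity z

  Σmultiplicity³≡∑³common : Σmultiplicity³ ≡ ∑³ common
  Σmultiplicity³≡∑³common = trans (sum-cong-≗ λ z → sum-cubed λ i → χ (agrees i z))
                            (∑-∑³-comm λ z i j k → χ (agrees i z) * χ (agrees j z) * χ (agrees k z))

  Σmultiplicity³-bound : Σmultiplicity³ + m * (m * (m * h)) ≤ m * (m * (m * n)) + goodCount * h
  Σmultiplicity³-bound = begin
    Σmultiplicity³ + m * (m * (m * h))
      ≡⟨ cong₂ _+_ Σmultiplicity³≡∑³common (sym (∑³-replicate {m} h)) ⟩
    ∑³ common + ∑³ {m} (λ _ _ _ → h)
      ≡⟨ sym (∑³-distrib-+ common λ _ _ _ → h) ⟩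
    ∑³ (λ i j k → common i j k + h)
      ≤⟨ ∑³-mono-≤ common+h≤n+good*h ⟩
    ∑³ (λ i j k → n + χ (good i j k) * h)
      ≡⟨ ∑³-distrib-+ (λ _ _ _ → n) (λ i j k → χ (good i j k) * h) ⟩
    ∑³ {m} (λ _ _ _ → n) + ∑³ (λ i j k → χ (good i j k) * h)
      ≡⟨ cong₂ _+_ (∑³-replicate {m} n) (∑³-*ʳ (λ i j k → χ (good i j k)) h) ⟩
    m * (m * (m * n)) + goodCount * h ∎
    where open ≤-Reasoning

  pairCount : Fin m → Fin m → ℕ
  pairCount i j = sum λ k → χ (good i j k)

  -- diagonal pairs are discarded: interpolating through wᵢ and wⱼ needs xᵢ ≉ xⱼ
  offDiagonal : Fin m → Fin m → ℕ
  offDiagonal i j with i Fin.≟ j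
  ... | yes _ = 0
  ... | no  _ = pairCount i j

  pairCount≤offDiagonal : ∀ i j → i ≢ j → pairCount i j ≤ offDiagonal i j
  pairCount≤offDiagonal i j i≢j with i Fin.≟ j
  ... | yes i≡j = ⊥-elim (i≢j i≡j)
  ... | no  _   = ≤-refl

  offDiagonal-nonZero : ∀ i j → 0 < offDiagonal i j → i ≢ j × offDiagonal i j ≡ pairCount i j
  offDiagonal-nonZero i j 0<o with i Fin.≟ j
  ... | no i≢j = i≢j , refl

  bestRow : Fin m → Fin m
  bestRow i = proj₁ (argmax (offDiagonal i))

  bestI : Fin m
  bestI = proj₁ (argmax λ i → offDiagonal i (bestRow i))

  bestJ : Fin m
  bestJ = bestRow bestI

  maxPairCount : ℕ
  maxPairCount = offDiagonal bestI bestJ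

  offDiagonal≤max : ∀ i j → offDiagonal i j ≤ maxPairCount
  offDiagonal≤max i j = ≤-trans (proj₂ (argmax (offDiagonal i)) j) (proj₂ (argmax λ i → offDiagonal i (bestRow i)) i)

  goodCount-bound : goodCount ≤ m * (m + m * maxPairCount)
  goodCount-bound = begin
    sum (λ i → sum (pairCount i))
      ≤⟨ sum-mono-≤ (λ i → sum-mono-≤-except i (λ j j≢i → pairCount≤offDiagonal i j (j≢i ∘ sym))
                                                 (sum-≤-length λ k → χ≤1 (good i i k))) ⟩
    sum (λ i → m + sum (offDiagonal i))
      ≤⟨ sum-mono-≤ (λ i → +-monoʳ-≤ m (subst (sum (offDiagonal i) ≤_) (sum-replicate {m} maxPairCount)
                                                                      (sum-mono-≤ (offDiagonal≤max i)))) ⟩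
    sum {m} (λ _ → m + m * maxPairCount)
      ≡⟨ sum-replicate {m} _ ⟩
    m * (m + m * maxPairCount) ∎
    where open ≤-Reasoning

  χ∧≤χ : ∀ a b → χ (a ∧ b) ≤ χ a
  χ∧≤χ true  b = χ≤1 b
  χ∧≤χ false b = z≤n

  χ-∧ : ∀ a b → χ (a ∧ b) ≡ χ a * χ b
  χ-∧ true  b = sym (+-identityʳ (χ b))
  χ-∧ false b = refl

  on-line : ∀ k z → agrees k z ≡ true → u* z 𝔽.+ x k 𝔽.* u z ≈ w k z
  on-line k z = from-does (line k z ≟ w k z)

  module BestPair (i j : Fin m) (i≢j : i ≢ j) where

    private
      xᵢ-xⱼ-invertible : Σ 𝔽.Carrier λ c → (x i 𝔽.- x j) 𝔽.* c ≈ 𝔽.1#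
      xᵢ-xⱼ-invertible = 𝔽.inverse (x i 𝔽.- x j) (x≉y⇒x-y≉0 (x-distinct i j i≢j))
      module Interpolate z = Interpolation (proj₂ xᵢ-xⱼ-invertible) (w i z) (w j z)

    v : Word F n
    v = _⊙_ F (proj₁ xᵢ-xⱼ-invertible) (_⊕_ F (w i) (_⊙_ F (𝔽.- 𝔽.1#) (w j)))

    v* : Word F n
    v* = _⊕_ F (w i) (_⊙_ F (𝔽.- x i) v)

    v∈V : V v
    v∈V = ·-closed _ (+-closed (w∈V i) (·-closed (𝔽.- 𝔽.1#) (w∈V j)))

    v*∈V : V v*
    v*∈V = +-closed (w∈V i) (·-closed (𝔽.- x i) v∈V)

    codeword : Fin m → Word F n
    codeword k = _⊕_ F v* (_⊙_ F (x k) v)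

    codeword∈V : ∀ k → V (codeword k)
    codeword∈V k = +-closed v*∈V (·-closed (x k) v∈V)

    agrees-i-j⇒on-v : ∀ z → agrees i z ≡ true → agrees j z ≡ true → u z ≈ v z × u* z ≈ v* z
    agrees-i-j⇒on-v z aᵢ aⱼ = line-unique (x-distinct i j i≢j)
      (𝔽.trans (on-line i z aᵢ) (𝔽.sym (Interpolate.intercept+x*slope≈p z)))
      (𝔽.trans (on-line j z aⱼ) (𝔽.sym (Interpolate.intercept+x'*slope≈p' z)))

    -- wₖ and codeword k agree wherever lines i, j and k all agree, i.e. on more than n − h points.
    good⇒w≈codeword : ∀ k → good i j k ≡ true → ∀ z → w k z ≈ codeword k z
    good⇒w≈codeword k gd = distance≥h (w k) (codeword k) (w∈V k) (codeword∈V k) (+-cancelʳ-< (common i j k) _ h (begin-strict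
      hamming F (w k) (codeword k) + common i j k
        ≤⟨ +-monoʳ-≤ _ (sum-mono-≤ λ z → common⇒agree z (agrees i z) (agrees j z) (agrees k z) refl refl refl) ⟩
      hamming F (w k) (codeword k) + sum (λ z → χ (does (w k z ≟ codeword k z)))
        ≡⟨ hamming+agreements (w k) (codeword k) ⟩
      n
        <⟨ from-does (good? i j k) gd ⟩
      h + common i j k ∎))
      where
      open ≤-Reasoning
      common⇒agree : ∀ z aᵢ aⱼ aₖ → agrees i z ≡ aᵢ → agrees j z ≡ aⱼ → agrees k z ≡ aₖ →
        χ aᵢ * χ aⱼ * χ aₖ ≤ χ (does (w k z ≟ codeword k z))
      common⇒agree z true true true eᵢ eⱼ eₖ with agrees-i-j⇒on-v z eᵢ eⱼ
      ... | u≈v , u*≈v* = ≤-reflexive (sym (cong χ (dec-true (w k z ≟ codeword k z)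
            (𝔽.trans (𝔽.sym (on-line k z eₖ)) (𝔽.+-cong u*≈v* (𝔽.*-cong 𝔽.refl u≈v))))))
      common⇒agree z true true false _ _ _ = z≤n
      common⇒agree z true false _ _ _ _ = z≤n
      common⇒agree z false _ _ _ _ _ = z≤n

    on-v? : ∀ z → Dec (u z ≈ v z × u* z ≈ v* z)
    on-v? z = (u z ≟ v z) ×-dec (u* z ≟ v* z)

    C : Subset n
    C = tabulate (does ∘ on-v?)

    C⇒on-v : ∀ z → z ∈ C → u z ≈ v z × u* z ≈ v* z
    C⇒on-v z z∈C = from-does (on-v? z) (∈tabulate⇒ (does ∘ on-v?) z z∈C)

    goodAgreeing : Fin n → Fin m → Bool
    goodAgreeing z k = good i j k ∧ agrees k z

    -- Two good codewords agreeing with u* + x u at z would put (u* z, u z) on the line of (v* z, v z)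
    -- at two distinct points, forcing z ∈ C.
    goodAgreeing-unique : ∀ z → does (on-v? z) ≡ false → sum (λ k → χ (goodAgreeing z k)) ≤ 1
    goodAgreeing-unique z off = sum-χ-≤1 (goodAgreeing z) λ k k' k≢k' gaₖ gaₖ' →
      false≢true (trans (sym off) (dec-true (on-v? z)
        (line-unique (x-distinct k k' k≢k') (on-codeword k gaₖ) (on-codeword k' gaₖ'))))
      where
      on-codeword : ∀ k → goodAgreeing z k ≡ true → u* z 𝔽.+ x k 𝔽.* u z ≈ codeword k z
      on-codeword k ga with good i j k in gd | agrees k z in ag
      on-codeword k refl | true | true = 𝔽.trans (on-line k z ag) (good⇒w≈codeword k gd z)
      false≢true : false ≢ true
      false≢true ()

    M : ℕ
    M = pairCount i j

    E : ℕ
    E = sum λ k → χ (good i j k) * distance k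

    goodAgreeingCount : Fin n → ℕ
    goodAgreeingCount z = sum λ k → χ (goodAgreeing z k)

    goodAgreeingCount+onC : ∀ z → goodAgreeingCount z + χ (does (on-v? z)) ≤ 1 + χ (does (on-v? z)) * M
    goodAgreeingCount+onC z with does (on-v? z) in onv
    ... | true  = ≤-trans (≤-reflexive (+-comm _ 1))
                    (+-monoʳ-≤ 1 (≤-trans (sum-mono-≤ λ k → χ∧≤χ (good i j k) (agrees k z)) (≤-reflexive (sym (+-identityʳ M)))))
    ... | false = ≤-trans (≤-reflexive (+-identityʳ _)) (goodAgreeing-unique z onv)

    goodAgreeing+distance : sum goodAgreeingCount + E ≡ M * n
    goodAgreeing+distance = begin
      sum goodAgreeingCount + E
        ≡⟨ cong (_+ E) (∑-comm λ z k → χ (goodAgreeing z k)) ⟩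
      sum (λ k → sum λ z → χ (goodAgreeing z k)) + E
        ≡⟨ sym (∑-distrib-+ (λ k → sum λ z → χ (goodAgreeing z k)) (λ k → χ (good i j k) * distance k)) ⟩
      sum (λ k → sum (λ z → χ (goodAgreeing z k)) + χ (good i j k) * distance k)
        ≡⟨ sum-cong-≗ per-codeword ⟩
      sum (λ k → χ (good i j k) * n)
        ≡⟨ sym (*-distribʳ-sum n λ k → χ (good i j k)) ⟩
      M * n ∎
      where
      open ≡-Reasoning
      per-codeword : ∀ k → sum (λ z → χ (goodAgreeing z k)) + χ (good i j k) * distance k ≡ χ (good i j k) * n
      per-codeword k = begin
        sum (λ z → χ (good i j k ∧ agrees k z)) + χ (good i j k) * distance k
          ≡⟨ cong (_+ χ (good i j k) * distance k) (trans (sum-cong-≗ λ z → χ-∧ (good i j k) (agrees k z))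
                                                            (sym (*-distribˡ-sum (χ (good i j k)) λ z → χ (agrees k z)))) ⟩
        χ (good i j k) * sum (λ z → χ (agrees k z)) + χ (good i j k) * distance k
          ≡⟨ sym (*-distribˡ-+ (χ (good i j k)) _ (distance k)) ⟩
        χ (good i j k) * (sum (λ z → χ (agrees k z)) + distance k)
          ≡⟨ cong (χ (good i j k) *_) (trans (+-comm _ (distance k)) (hamming+agreements (line k) (w k))) ⟩
        χ (good i j k) * n ∎

    ∣C∣-bound : M * n + ∣ C ∣ ≤ E + ∣ C ∣ * M + n
    ∣C∣-bound = begin
      M * n + ∣ C ∣
        ≡⟨ cong₂ _+_ (sym goodAgreeing+distance) (∣tabulate∣ (does ∘ on-v?)) ⟩
      sum goodAgreeingCount + E + sum onC
        ≡⟨ xy∙z≈xz∙y (sum goodAgreeingCount) E (sum onC) ⟩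
      sum goodAgreeingCount + sum onC + E
        ≡⟨ cong (_+ E) (sym (∑-distrib-+ goodAgreeingCount onC)) ⟩
      sum (λ z → goodAgreeingCount z + onC z) + E
        ≤⟨ +-monoˡ-≤ E (sum-mono-≤ goodAgreeingCount+onC) ⟩
      sum (λ z → 1 + onC z * M) + E
        ≡⟨ cong (_+ E) (trans (∑-distrib-+ (λ _ → 1) (λ z → onC z * M))
                               (cong₂ _+_ (trans (sum-replicate {n} 1) (*-identityʳ n)) (sym (*-distribʳ-sum M onC)))) ⟩
      n + sum onC * M + E
        ≡⟨ cong (λ c → n + c * M + E) (sym (∣tabulate∣ (does ∘ on-v?))) ⟩
      n + ∣ C ∣ * M + E
        ≡⟨ xy∙z≈zy∙x n (∣ C ∣ * M) E ⟩
      E + ∣ C ∣ * M + n ∎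
      where
      open ≤-Reasoning
      onC : Fin n → ℕ
      onC z = χ (does (on-v? z))

module ProximityGap {c ℓ p} (F : FiniteField c ℓ) {n : ℕ} .{{_ : ℕ.NonZero n}}
  (V : Pred (Word F n) p) (linear : IsLinearCode F V)
  (lam : ℚ) (h : ℕ) (lam*n≡h : lam Q.* ι n ≡ ι h) (h≤n : h ℕ.≤ n)
  (distance≥h : ∀ a b → V a → V b → hamming F a b ℕ.< h → ∀ z → FiniteField._≈_ F (a z) (b z))
  (ε δ : ℚ) (0<ε : 0ℚ Q.< ε) (0<δ : 0ℚ Q.< δ) (ε<1/3 : ε Q.< + 1 / 3)
  (cube-gap : 1ℚ Q.- lam Q.+ ε Q.< (1ℚ Q.- δ) Q.* (1ℚ Q.- δ) Q.* (1ℚ Q.- δ))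
  (u u* : Word F n)
  where

  open import Level using (_⊔_)
  open import Data.Nat using (suc)
  import Data.Nat.Properties as ℕ
  open import Data.Bool using (true; false)
  open import Data.Product using (_,_; proj₁; proj₂)
  open import Data.Rational using (_+_; _*_; _-_; _≤_; _<_)
  open import Data.Rational.Properties
  open import Data.Rational.Solver using (module +-*-Solver)
  open import Function using (_∘_)
  open import Relation.Binary.PropositionalEquality using (refl; sym; trans; cong; cong₂; subst; subst₂)
  open import Algebra.Properties.Semiring.Sum ℕ.+-*-semiring using (sum)
  open FiniteSums
  open RationalArithmetic
  open CountingInequalities

  CorrelatedAgreement : Set (c ⊔ ℓ ⊔ p)
  CorrelatedAgreement = Σ (Word F n) λ v → Σ (Word F n) λ v* → V v × V v* ×
    Σ (Subset n) λ C → ((1ℚ - δ - ε) * ι n ≤ ι ∣ C ∣) ×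
      (∀ z → z ∈ C → FiniteField._≈_ F (u z) (v z) × FiniteField._≈_ F (u* z) (v* z))

  0<n : 0ℚ < ι n
  0<n = ι-mono-< (ℕ.>-nonZero⁻¹ n)

  lam*n≤n : lam * ι n ≤ ι n
  lam*n≤n = subst (_≤ ι n) (sym lam*n≡h) (ι-mono-≤ h≤n)

  lam≤1 : lam ≤ 1ℚ
  lam≤1 = *-cancelʳ-≤-pos {lam} {1ℚ} (ι n) {{Q.positive 0<n}} (subst (lam * ι n ≤_) (sym (*-identityˡ (ι n))) lam*n≤n)

  0≤1-δ : 0ℚ ≤ 1ℚ - δ
  0≤1-δ = <⇒≤ (p<q⇒0<q-p (δ<1 {lam} {ε} {δ} lam≤1 0<ε cube-gap))

  module _ {m₀ : ℕ} (x : Fin (suc m₀) → FiniteField.Carrier F)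
    (x-distinct : ∀ i j → i ≢ j → ¬ FiniteField._≈_ F (x i) (x j))
    (close : ∀ i → CloseTo F (_⊕_ F u* (_⊙_ F (x i) u)) V δ)
    (2≤mε² : ι 2 Q.≤ ι (suc m₀) Q.* (ε Q.* ε))
    where

    open Agreement F V linear h distance≥h u u* x x-distinct (proj₁ ∘ close) (proj₁ ∘ proj₂ ∘ close)

    0<m : 0ℚ < ι m
    0<m = ι-mono-< {0} {m} (ℕ.s≤s ℕ.z≤n)

    distance≤δn : ∀ i → ι (distance i) ≤ δ * ι n
    distance≤δn i = <⇒≤ (subst (_< δ * ι n) ([a/n]*n≡a (distance i) n)
      (*-monoˡ-<-pos (ι n) {{Q.positive 0<n}} (proj₂ (proj₂ (close i)))))

    ι-m³ : ∀ k → ι (m ℕ.* (m ℕ.* (m ℕ.* k))) ≡ ι m * ι m * ι m * ι k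
    ι-m³ k = trans (ι-* m (m ℕ.* (m ℕ.* k))) (trans (cong (ι m *_) (trans (ι-* m (m ℕ.* k)) (cong (ι m *_) (ι-* m k))))
      (solve 2 (λ m k → m :* (m :* (m :* k)) := m :* m :* m :* k) refl (ι m) (ι k)))
      where open +-*-Solver

    many-good-triples : ι m * ι m * ι m * ε < ι goodCount
    many-good-triples = good-triples-lower-bound {ι n} {ι m} {δ} {ε} {lam} 0<m 0<n lam*n≤n (0≤ι goodCount) counted cube-moment cube-gap
      where
      S₁ : ℕ
      S₁ = sum multiplicity
      μ : ℚ
      μ = ι m * (1ℚ - δ)
      first-moment : ι n * μ ≤ ι S₁
      first-moment = first-moment-bound {ι n} {ι m} {δ}
        (trans (sym (ι-+ S₁ (sum distance))) (trans (cong ι multiplicity+distance) (ι-* m n)))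
        (subst (λ k → ι (sum distance) ≤ ι k * (δ * ι n)) (trans (sum-replicate {m} 1) (ℕ.*-identityʳ m))
          (ι-sum-≤-scaled distance (λ _ → 1) (δ * ι n) λ i → subst (ι (distance i) ≤_) (sym (*-identityˡ _)) (distance≤δn i)))
      cube-moment : ι n * (μ * μ * μ) ≤ ι Σmultiplicity³
      cube-moment = mean-cube-bound multiplicity (0≤* (0≤ι m) 0≤1-δ) first-moment
      counted : ι Σmultiplicity³ + ι m * ι m * ι m * (lam * ι n)
              ≤ ι m * ι m * ι m * ι n + ι goodCount * (lam * ι n)
      counted = subst₂ _≤_
        (trans (ι-+ Σmultiplicity³ (m ℕ.* (m ℕ.* (m ℕ.* h)))) (cong (λ t → ι Σmultiplicity³ + t) (trans (ι-m³ h) (cong (ι m * ι m * ι m *_) (sym lam*n≡h)))))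
        (trans (ι-+ (m ℕ.* (m ℕ.* (m ℕ.* n))) (goodCount ℕ.* h)) (cong₂ _+_ (ι-m³ n) (trans (ι-* goodCount h) (cong (ι goodCount *_) (sym lam*n≡h)))))
        (ι-mono-≤ Σmultiplicity³-bound)

    rich-pair : δ < (ι maxPairCount - 1ℚ) * ε
    rich-pair = pair-count-lower-bound {ι m} {ε} {δ} {ι goodCount} {ι maxPairCount} 0<m 0<ε ε<1/3 (δ<1 {lam} {ε} {δ} lam≤1 0<ε cube-gap) 2≤mε²
      (subst (ι goodCount ≤_) m[m+mM]≡m²[1+M] (ι-mono-≤ goodCount-bound)) many-good-triples
      where
      open +-*-Solver
      m[m+mM]≡m²[1+M] : ι (m ℕ.* (m ℕ.+ m ℕ.* maxPairCount)) ≡ ι m * ι m * (1ℚ + ι maxPairCount)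
      m[m+mM]≡m²[1+M] = trans (ι-* m (m ℕ.+ m ℕ.* maxPairCount)) (trans (cong (ι m *_) (trans (ι-+ m (m ℕ.* maxPairCount)) (cong (λ t → ι m + t) (ι-* m maxPairCount))))
        (solve 2 (λ m M → m :* (m :+ m :* M) := m :* m :* (con 1ℚ :+ M)) refl (ι m) (ι maxPairCount)))

    χ-scaled : ∀ b {d r} → ι d ≤ r → ι (χ b ℕ.* d) ≤ ι (χ b) * r
    χ-scaled true  {d} {r} ιd≤r = subst₂ _≤_ (cong ι (sym (ℕ.+-identityʳ d))) (sym (*-identityˡ r)) ιd≤r
    χ-scaled false {d} {r} _    = ≤-reflexive (sym (*-zeroˡ r))

    correlated-agreement : CorrelatedAgreement
    correlated-agreement = v , v* , v∈V , v*∈V , C , large , C⇒on-v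
      where
      0<maxPairCount : 0 ℕ.< maxPairCount
      0<maxPairCount = ι-cancel-≤ (<⇒≤ (1<M {ι maxPairCount} 0<δ 0<ε rich-pair))
      pair : bestI ≢ bestJ × offDiagonal bestI bestJ ≡ pairCount bestI bestJ
      pair = offDiagonal-nonZero bestI bestJ 0<maxPairCount
      open BestPair bestI bestJ (proj₁ pair)
      E≤ : ι E ≤ ι M * (δ * ι n)
      E≤ = ι-sum-≤-scaled (λ k → χ (good bestI bestJ k) ℕ.* distance k) (λ k → χ (good bestI bestJ k)) (δ * ι n)
             λ k → χ-scaled (good bestI bestJ k) (distance≤δn k)
      counted : ι M * ι n + ι ∣ C ∣ ≤ ι E + ι ∣ C ∣ * ι M + ι n
      counted = subst₂ _≤_
        (trans (ι-+ (M ℕ.* n) ∣ C ∣) (cong (_+ ι ∣ C ∣) (ι-* M n)))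
        (trans (ι-+ (E ℕ.+ ∣ C ∣ ℕ.* M) n) (cong (_+ ι n) (trans (ι-+ E (∣ C ∣ ℕ.* M)) (cong (λ t → ι E + t) (ι-* ∣ C ∣ M)))))
        (ι-mono-≤ ∣C∣-bound)
      large : (1ℚ - δ - ε) * ι n ≤ ι ∣ C ∣
      large = agreement-set-lower-bound {ι n} {ι M} (0≤ι n) 0<δ 0<ε E≤ counted
        (subst (λ k → δ < (ι k - 1ℚ) * ε) (proj₂ pair) rich-pair)

import Data.Nat.Properties as ℕ
import Data.Fin as Fin
import Data.Fin.Properties as Fin
open import Data.Rational.Properties using (<-irrefl; <-≤-trans; *-zeroˡ; *-monoʳ-≤-nonNeg; positive⁻¹)
open import Data.Product using (_,_)
open import Data.List using (List; []; _∷_; length; lookup)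
open import Data.List.Relation.Unary.All as All using (All)
open import Data.List.Relation.Unary.AllPairs using (AllPairs; _∷_)
open import Data.List.Membership.Propositional.Properties using (∈-lookup)
open import Data.Empty using (⊥-elim)
open import Function using (_∘_)
open import Relation.Nullary using (yes; no)
open import Relation.Binary.PropositionalEquality using (refl; sym; trans; cong; subst; subst₂)
open RationalArithmetic using (ι-cancel-≤; [a/n]*n≡a; 0≤ι)
open CountingInequalities using (count-from-probability)

AllPairs-lookup : ∀ {a r} {A : Set a} {R : A → A → Set r} → (∀ {x y} → R x y → R y x) → {xs : List A} →
  AllPairs R xs → ∀ i j → i ≢ j → R (lookup xs i) (lookup xs j)
AllPairs-lookup sym (_ ∷ _)       Fin.zero    Fin.zero    0≢0 = ⊥-elim (0≢0 refl)
AllPairs-lookup sym (R₀ ∷ _)      Fin.zero    (Fin.suc j) _   = All.lookup R₀ (∈-lookup j)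
AllPairs-lookup sym (R₀ ∷ _)      (Fin.suc i) Fin.zero    _   = sym (All.lookup R₀ (∈-lookup i))
AllPairs-lookup sym (_ ∷ pairs)   (Fin.suc i) (Fin.suc j) i≢j = AllPairs-lookup sym pairs i j (i≢j ∘ cong Fin.suc)

minimum-distance-count : ∀ {c ℓ p} (F : FiniteField c ℓ) {n} .{{_ : ℕ.NonZero n}} {V : Pred (Word F n) p} {lam} →
  IsMinDist F V lam →
  Σ ℕ λ h → lam Q.* ι n ≡ ι h × h ℕ.≤ n ×
    (∀ a b → V a → V b → hamming F a b ℕ.< h → ∀ z → FiniteField._≈_ F (a z) (b z))
minimum-distance-count F {n} {V} {lam} ((s , s' , _ , _ , _ , Δss'≡lam) , lam≤Δ) =
  h , lam*n≡h , hamming≤length s s' , distance≥h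
  where
  open Hamming F using (hamming≤length)
  open FiniteField F using (_≟_)
  h : ℕ
  h = hamming F s s'
  lam*n≡h : lam Q.* ι n ≡ ι h
  lam*n≡h = trans (cong (Q._* ι n) (sym Δss'≡lam)) ([a/n]*n≡a h n)
  distance≥h : ∀ a b → V a → V b → hamming F a b ℕ.< h → ∀ z → FiniteField._≈_ F (a z) (b z)
  distance≥h a b a∈V b∈V close with Fin.all? (λ z → a z ≟ b z)
  ... | yes a≈b = a≈b
  ... | no  a≉b = ⊥-elim (ℕ.<⇒≱ close (ι-cancel-≤ (subst₂ Q._≤_ lam*n≡h ([a/n]*n≡a (hamming F a b) n)
                    (*-monoʳ-≤-nonNeg (ι n) {{Q.nonNegative (0≤ι n)}} (lam≤Δ a b a∈V b∈V a≉b)))))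

mainTheorem2 : ∀ {c ℓ p} (F : FiniteField c ℓ) (n : ℕ) .{{_ : ℕ.NonZero n}}
  (V : Pred (Word F n) p) → IsLinearCode F V →
  (lam : ℚ) → IsMinDist F V lam →
  (ε δ : ℚ) (ε>0 : 0ℚ Q.< ε) → 0ℚ Q.< δ → ε Q.< (+ 1 / 3) →
  (1ℚ Q.- lam Q.+ ε) Q.< ((1ℚ Q.- δ) Q.* (1ℚ Q.- δ) Q.* (1ℚ Q.- δ)) →
  (u u* : Word F n) →
  PrAtLeast F (λ x → CloseTo F (_⊕_ F u* (_⊙_ F x u)) V δ)
    (((_/_ (+ 2) (FiniteField.q F) {{FiniteField.q-nonZero F}})
      Q.* (1/_ ε {{>-nonZero ε>0}})) Q.* (1/_ ε {{>-nonZero ε>0}})) →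
  Σ (Word F n) λ v → Σ (Word F n) λ v* → V v × V v* ×
    Σ (Subset n) λ C →
      (((1ℚ Q.- δ Q.- ε) Q.* ((+ n) / 1)) Q.≤ ((+ ∣ C ∣) / 1)) ×
      (∀ z → z ∈ C →
        FiniteField._≈_ F (u z) (v z) × FiniteField._≈_ F (u* z) (v* z))
mainTheorem2 F n V linear lam minDist ε δ 0<ε 0<δ ε<1/3 cube-gap u u* (xs , xs-distinct , xs-close , xs-many)
  with minimum-distance-count F minDist
... | h , lam*n≡h , h≤n , distance≥h =
  from-list xs xs-distinct xs-close (count-from-probability q {{q-nonZero}} ε 0<ε (length xs) xs-many)
  where
  open FiniteField F using (Carrier; _≈_; q; q-nonZero)
  open ProximityGap F V linear lam h lam*n≡h h≤n distance≥h ε δ 0<ε 0<δ ε<1/3 cube-gap u u*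
  from-list : (xs : List Carrier) → AllPairs (λ x y → ¬ x ≈ y) xs → All (λ x → CloseTo F (_⊕_ F u* (_⊙_ F x u)) V δ) xs →
    ι 2 Q.≤ ι (length xs) Q.* (ε Q.* ε) → CorrelatedAgreement
  from-list [] _ _ 2≤0 = ⊥-elim (<-irrefl refl (<-≤-trans (positive⁻¹ (ι 2)) (subst (ι 2 Q.≤_) (*-zeroˡ (ε Q.* ε)) 2≤0)))
  from-list xs@(_ ∷ _) distinct close 2≤mε² =
    correlated-agreement (lookup xs) (AllPairs-lookup (λ x≉y → x≉y ∘ FiniteField.sym F) distinct)
      (λ i → All.lookup close (∈-lookup i)) 2≤mε²
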